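{- Consider an Unbounded Knapsack instance with weights $w_1,\dots,w_n\in[1,u]$ and profits $p_1,\dots,p_n\in\mathbb{Z}$. For any lexical order $\sigma$ and any feasible target $j$, let $x=\mathsf{sol}(j,\sigma)$. Then $\prod_{i=1}^n(x_i+1)\le j+1$.
   Context: A solution to a sum $c$ is $m\in\mathbb{N}^n$ with $\sum_i w_im_i=c$; $c$ is feasible if one exists. Its value is $\sum_i p_im_i$, and a solution is optimal if it has maximum value among solutions to the same sum. A lexical order $\sigma$ is a permutation of $\{1,\dots,n\}$; solution $A$ is lexicographically smaller than $B$ under $\sigma$ if there is $j$ with $a_{\sigma_k}=b_{\sigma_k}$ for all $k<j$ and $a_{\sigma_j}>b_{\sigma_j}$. $\mathsf{sol}(j,\sigma)$ is the lexicographically smallest (under $\sigma$) optimal solution to $j$. -}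

module Defs where

open import Data.Nat as ℕ using (ℕ; zero; suc; _+_; _*_)
open import Data.Integer as ℤ using (ℤ)
open import Data.Fin using (Fin; zero; suc; _<_)
open import Data.Fin.Permutation using (Permutation′; _⟨$⟩ʳ_)
open import Data.Product using (Σ; _×_)
open import Data.Sum using (_⊎_)
open import Relation.Binary.PropositionalEquality using (_≡_)

sumℕ : ∀ {n} → (Fin n → ℕ) → ℕ
sumℕ {zero} f = 0
sumℕ {suc n} f = f zero + sumℕ (λ i → f (suc i))

sumℤ : ∀ {n} → (Fin n → ℤ) → ℤ
sumℤ {zero} f = ℤ.0ℤ
sumℤ {suc n} f = f zero ℤ.+ sumℤ (λ i → f (suc i))

prodℕ : ∀ {n} → (Fin n → ℕ) → ℕ
prodℕ {zero} f = 1
prodℕ {suc n} f = f zero * prodℕ (λ i → f (suc i))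

IsSolution : ∀ {n} → (w : Fin n → ℕ) → ℕ → (Fin n → ℕ) → Set
IsSolution w c m = sumℕ (λ i → w i * m i) ≡ c

value : ∀ {n} → (Fin n → ℤ) → (Fin n → ℕ) → ℤ
value p m = sumℤ (λ i → p i ℤ.* ℤ.+ (m i))

IsOptimal : ∀ {n} → (Fin n → ℕ) → (Fin n → ℤ) → ℕ → (Fin n → ℕ) → Set
IsOptimal w p c m =
  IsSolution w c m × (∀ m′ → IsSolution w c m′ → value p m′ ℤ.≤ value p m)

-- A is lexicographically smaller than B under σ (as in the paper:
-- at the first differing position σ_j, a_{σ_j} > b_{σ_j})
LexSmaller : ∀ {n} → Permutation′ n → (Fin n → ℕ) → (Fin n → ℕ) → Set
LexSmaller {n} σ a b =
  Σ (Fin n) λ j →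
    (∀ k → k < j → a (σ ⟨$⟩ʳ k) ≡ b (σ ⟨$⟩ʳ k)) × b (σ ⟨$⟩ʳ j) ℕ.< a (σ ⟨$⟩ʳ j)

IsSol : ∀ {n} → (Fin n → ℕ) → (Fin n → ℤ) → ℕ → Permutation′ n → (Fin n → ℕ) → Set
IsSol w p c σ x =
  IsOptimal w p c x ×
  (∀ y → IsOptimal w p c y → (∀ i → x i ≡ y i) ⊎ LexSmaller σ x y)

-- The sub-vectors y ≤ x of x are ∏ (x_i + 1) in number and their weights
-- Σ w_i y_i lie in {0, …, j}, so it suffices that distinct sub-vectors have
-- distinct weights. If y ≠ y' had equal weights, replacing y by y' inside x,
-- and y' by y, would give two solutions to j whose values add up to twice the
-- value of x; both are then optimal. As x = sol(j, σ) is lexicographically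
-- smaller than both, at the first σ-position where y and y' differ we would
-- need both y > y' and y' > y.
module Submission where

open import Defs
open import Data.Nat using (ℕ; _≤_; _+_; suc)
open import Data.Integer using (ℤ)
open import Data.Fin using (Fin)
open import Data.Fin.Permutation using (Permutation′)

open import Data.Nat as ℕ using (_<_; _∸_; _*_; z≤n; s≤s)
import Data.Nat.Properties as ℕ
import Data.Integer as ℤ
import Data.Integer.Properties as ℤ
import Data.Fin as F
import Data.Fin.Properties as F
open import Data.Product using (_,_; proj₁; proj₂; uncurry)
open import Data.Sum using (inj₁; inj₂)
open import Data.Empty using (⊥)
open import Relation.Binary.PropositionalEquality
open import Relation.Binary.Definitions using (tri<; tri≈; tri>)
import Algebra.Properties.CommutativeSemigroup as CommutativeSemigroupProperties
open import Algebra.Properties.AbelianGroup ℤ.+-0-abelianGroup using (∙-cancelʳ)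

open CommutativeSemigroupProperties ℕ.+-commutativeSemigroup
  using (xy∙z≈xz∙y) renaming (interchange to ℕ-+-interchange)
open CommutativeSemigroupProperties ℤ.+-commutativeSemigroup
  using () renaming (interchange to ℤ-+-interchange)

m≡m∸n+o⇒n≡o : ∀ {m n o} → n ≤ m → m ≡ m ∸ n + o → n ≡ o
m≡m∸n+o⇒n≡o {m} {n} {o} n≤m eq = ℕ.+-cancelˡ-≡ (m ∸ n) n o (trans (ℕ.m∸n+n≡m n≤m) eq)

m∸n+o<m⇒o<n : ∀ {m n o} → n ≤ m → m ∸ n + o < m → o < n
m∸n+o<m⇒o<n {m} {n} {o} n≤m lt =
  ℕ.+-cancelˡ-< (m ∸ n) o n (subst (m ∸ n + o <_) (sym (ℕ.m∸n+n≡m n≤m)) lt)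

sumℕ-cong : ∀ {n} {f g : Fin n → ℕ} → (∀ i → f i ≡ g i) → sumℕ f ≡ sumℕ g
sumℕ-cong {ℕ.zero} f≗g = refl
sumℕ-cong {suc n}  f≗g = cong₂ _+_ (f≗g F.zero) (sumℕ-cong (λ i → f≗g (F.suc i)))

sumℕ-+ : ∀ {n} (f g : Fin n → ℕ) → sumℕ (λ i → f i + g i) ≡ sumℕ f + sumℕ g
sumℕ-+ {ℕ.zero} f g = refl
sumℕ-+ {suc n}  f g = trans
  (cong ((f F.zero + g F.zero) +_) (sumℕ-+ (λ i → f (F.suc i)) (λ i → g (F.suc i))))
  (ℕ-+-interchange (f F.zero) (g F.zero) _ _)

sumℕ-mono-≤ : ∀ {n} {f g : Fin n → ℕ} → (∀ i → f i ≤ g i) → sumℕ f ≤ sumℕ g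
sumℕ-mono-≤ {ℕ.zero} f≤g = z≤n
sumℕ-mono-≤ {suc n}  f≤g = ℕ.+-mono-≤ (f≤g F.zero) (sumℕ-mono-≤ (λ i → f≤g (F.suc i)))

sumℤ-cong : ∀ {n} {f g : Fin n → ℤ} → (∀ i → f i ≡ g i) → sumℤ f ≡ sumℤ g
sumℤ-cong {ℕ.zero} f≗g = refl
sumℤ-cong {suc n}  f≗g = cong₂ ℤ._+_ (f≗g F.zero) (sumℤ-cong (λ i → f≗g (F.suc i)))

sumℤ-+ : ∀ {n} (f g : Fin n → ℤ) → sumℤ (λ i → f i ℤ.+ g i) ≡ sumℤ f ℤ.+ sumℤ g
sumℤ-+ {ℕ.zero} f g = refl
sumℤ-+ {suc n}  f g = trans
  (cong (ℤ._+_ (f F.zero ℤ.+ g F.zero)) (sumℤ-+ (λ i → f (F.suc i)) (λ i → g (F.suc i))))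
  (ℤ-+-interchange (f F.zero) (g F.zero) _ _)

module _ {n : ℕ} where

  weight : (Fin n → ℕ) → (Fin n → ℕ) → ℕ
  weight w m = sumℕ (λ i → w i * m i)

  weight-+ : ∀ w (a b : Fin n → ℕ) →
             weight w (λ i → a i + b i) ≡ weight w a + weight w b
  weight-+ w a b = trans (sumℕ-cong (λ i → ℕ.*-distribˡ-+ (w i) (a i) (b i)))
                         (sumℕ-+ (λ i → w i * a i) (λ i → w i * b i))

  value-+ : ∀ p (a b : Fin n → ℕ) →
            value p (λ i → a i + b i) ≡ value p a ℤ.+ value p b
  value-+ p a b = trans (sumℤ-cong pointwise)
                        (sumℤ-+ (λ i → p i ℤ.* ℤ.+ a i) (λ i → p i ℤ.* ℤ.+ b i))
    where
    pointwise : ∀ i → p i ℤ.* ℤ.+ (a i + b i) ≡ p i ℤ.* ℤ.+ a i ℤ.+ p i ℤ.* ℤ.+ b i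
    pointwise i = trans (cong (p i ℤ.*_) (ℤ.pos-+ (a i) (b i)))
                        (ℤ.*-distribˡ-+ (p i) (ℤ.+ a i) (ℤ.+ b i))

  _≤ᵖ_ : (Fin n → ℕ) → (Fin n → ℕ) → Set
  a ≤ᵖ b = ∀ i → a i ≤ b i

  exchange : (x y y′ : Fin n → ℕ) → Fin n → ℕ
  exchange x y y′ i = x i ∸ y i + y′ i

  exchange-+ : ∀ {x y} y′ → y ≤ᵖ x → ∀ i → exchange x y y′ i + y i ≡ x i + y′ i
  exchange-+ {x} {y} y′ y≤x i =
    trans (xy∙z≈xz∙y (x i ∸ y i) (y′ i) (y i)) (cong (_+ y′ i) (ℕ.m∸n+n≡m (y≤x i)))

  weight-mono-≤ : ∀ w {a b} → a ≤ᵖ b → weight w a ≤ weight w b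
  weight-mono-≤ w a≤b = sumℕ-mono-≤ (λ i → ℕ.*-monoʳ-≤ (w i) (a≤b i))

  weight-exchange : ∀ w {x y} y′ → y ≤ᵖ x →
                    weight w (exchange x y y′) + weight w y ≡ weight w x + weight w y′
  weight-exchange w {x} {y} y′ y≤x = begin
    weight w (exchange x y y′) + weight w y   ≡⟨ weight-+ w (exchange x y y′) y ⟨
    weight w (λ i → exchange x y y′ i + y i)
      ≡⟨ sumℕ-cong (λ i → cong (w i *_) (exchange-+ y′ y≤x i)) ⟩
    weight w (λ i → x i + y′ i)               ≡⟨ weight-+ w x y′ ⟩
    weight w x + weight w y′                  ∎
    where open ≡-Reasoning

  value-exchange : ∀ p {x y} y′ → y ≤ᵖ x →
                   value p (exchange x y y′) ℤ.+ value p y ≡ value p x ℤ.+ value p y′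
  value-exchange p {x} {y} y′ y≤x = begin
    value p (exchange x y y′) ℤ.+ value p y   ≡⟨ value-+ p (exchange x y y′) y ⟨
    value p (λ i → exchange x y y′ i + y i)
      ≡⟨ sumℤ-cong (λ i → cong (λ k → p i ℤ.* ℤ.+ k) (exchange-+ y′ y≤x i)) ⟩
    value p (λ i → x i + y′ i)                ≡⟨ value-+ p x y′ ⟩
    value p x ℤ.+ value p y′                  ∎
    where open ≡-Reasoning

  exchange-solution : ∀ {w c x y y′} → IsSolution w c x → y ≤ᵖ x →
                      weight w y ≡ weight w y′ → IsSolution w c (exchange x y y′)
  exchange-solution {w} {y = y} {y′} x-sol y≤x wy≡wy′ =
    ℕ.+-cancelʳ-≡ (weight w y) _ _
      (trans (weight-exchange w y′ y≤x) (cong₂ _+_ x-sol (sym wy≡wy′)))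

  exchange-optimal : ∀ {w p c x y y′} → IsOptimal w p c x → y ≤ᵖ x → y′ ≤ᵖ x →
                     weight w y ≡ weight w y′ → IsOptimal w p c (exchange x y y′)
  exchange-optimal {w} {p} {c} {x} {y} {y′} (x-sol , x-max) y≤x y′≤x wy≡wy′ =
    z-sol , λ m m-sol → subst (value p m ℤ.≤_) (sym vz≡vx) (x-max m m-sol)
    where
    z-sol : IsSolution w c (exchange x y y′)
    z-sol = exchange-solution {w = w} x-sol y≤x wy≡wy′
    z′-sol : IsSolution w c (exchange x y′ y)
    z′-sol = exchange-solution {w = w} x-sol y′≤x (sym wy≡wy′)

    vx+vy≡vx+vy′ : value p x ℤ.+ value p y ≡ value p x ℤ.+ value p y′
    vx+vy≡vx+vy′ = ℤ.≤-antisym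
      (subst (ℤ._≤ _) (value-exchange p y y′≤x) (ℤ.+-monoˡ-≤ (value p y′) (x-max _ z′-sol)))
      (subst (ℤ._≤ _) (value-exchange p y′ y≤x) (ℤ.+-monoˡ-≤ (value p y) (x-max _ z-sol)))

    vz≡vx : value p (exchange x y y′) ≡ value p x
    vz≡vx = ∙-cancelʳ (value p y) _ _
      (trans (value-exchange p y′ y≤x) (sym vx+vy≡vx+vy′))

  LexSmaller-asym : ∀ (σ : Permutation′ n) {a b} → LexSmaller σ a b → LexSmaller σ b a → ⊥
  LexSmaller-asym σ (k , agree , b<a) (k′ , agree′ , a<b) with F.<-cmp k k′
  ... | tri< k<k′ _ _  = ℕ.<-irrefl (agree′ k k<k′) b<a
  ... | tri≈ _ refl _  = ℕ.<-asym b<a a<b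
  ... | tri> _ _ k′<k  = ℕ.<-irrefl (agree k′ k′<k) a<b

  LexSmaller-transfer : ∀ {σ : Permutation′ n} {a b c d} →
                        (∀ i → a i ≡ b i → c i ≡ d i) → (∀ i → b i < a i → d i < c i) →
                        LexSmaller σ a b → LexSmaller σ c d
  LexSmaller-transfer ≡⇒≡ <⇒< (k , agree , b<a) =
    k , (λ l l<k → ≡⇒≡ _ (agree l l<k)) , <⇒< _ b<a

  exchange-fixes⇒≗ : ∀ {x a b : Fin n → ℕ} → a ≤ᵖ x →
                     (∀ i → x i ≡ exchange x a b i) → ∀ i → a i ≡ b i
  exchange-fixes⇒≗ a≤x x≗z i = m≡m∸n+o⇒n≡o (a≤x i) (x≗z i)

  exchange-LexSmaller : ∀ {σ : Permutation′ n} {x a b} → a ≤ᵖ x →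
                        LexSmaller σ x (exchange x a b) → LexSmaller σ a b
  exchange-LexSmaller {σ} {x} {a} {b} a≤x =
    LexSmaller-transfer {σ} {x} {exchange x a b} {a} {b}
      (λ i → m≡m∸n+o⇒n≡o (a≤x i)) (λ i → m∸n+o<m⇒o<n (a≤x i))

  sol-weight-injective : ∀ {w : Fin n → ℕ} {p c σ x y y′} → IsSol w p c σ x →
                         y ≤ᵖ x → y′ ≤ᵖ x → weight w y ≡ weight w y′ → ∀ i → y i ≡ y′ i
  sol-weight-injective {w = w} {p} {σ = σ} {y = y} {y′} (x-opt , x-least) y≤x y′≤x wy≡wy′
    with x-least _ (exchange-optimal {w = w} {p = p} x-opt y≤x y′≤x wy≡wy′)
       | x-least _ (exchange-optimal {w = w} {p = p} x-opt y′≤x y≤x (sym wy≡wy′))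
  ... | inj₁ x≗z | _         = exchange-fixes⇒≗ y≤x x≗z
  ... | inj₂ _   | inj₁ x≗z′ = λ i → sym (exchange-fixes⇒≗ y′≤x x≗z′ i)
  ... | inj₂ x≺z | inj₂ x≺z′ with () ←
    LexSmaller-asym σ {y} {y′} (exchange-LexSmaller {σ = σ} {b = y′} y≤x x≺z)
                      (exchange-LexSmaller {σ = σ} {b = y} y′≤x x≺z′)

-- Mixed-radix decoding of an index into a lattice point of the box [0, x].
boxPoint : ∀ {n} (x : Fin n → ℕ) → Fin (prodℕ (λ i → suc (x i))) → Fin n → ℕ
boxPoint {suc n} x k F.zero    = F.toℕ (proj₁ (F.remQuot {suc (x F.zero)} _ k))
boxPoint {suc n} x k (F.suc i) = boxPoint (λ i → x (F.suc i)) (proj₂ (F.remQuot {suc (x F.zero)} _ k)) i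

boxPoint-≤ᵖ : ∀ {n} (x : Fin n → ℕ) k → boxPoint x k ≤ᵖ x
boxPoint-≤ᵖ {suc n} x k F.zero    = ℕ.≤-pred (F.toℕ<n (proj₁ (F.remQuot {suc (x F.zero)} _ k)))
boxPoint-≤ᵖ {suc n} x k (F.suc i) = boxPoint-≤ᵖ (λ i → x (F.suc i)) _ i

boxPoint-injective : ∀ {n} (x : Fin n → ℕ) k k′ →
                     (∀ i → boxPoint x k i ≡ boxPoint x k′ i) → k ≡ k′
boxPoint-injective {ℕ.zero} x F.zero F.zero _ = refl
boxPoint-injective {suc n}  x k k′ k≗k′ = begin
  k                                  ≡⟨ F.combine-remQuot {suc (x F.zero)} _ k ⟨
  uncurry F.combine (remQuot k)      ≡⟨ cong (uncurry F.combine) remQuot-≡ ⟩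
  uncurry F.combine (remQuot k′)     ≡⟨ F.combine-remQuot {suc (x F.zero)} _ k′ ⟩
  k′                                 ∎
  where
  open ≡-Reasoning
  remQuot = F.remQuot {suc (x F.zero)} (prodℕ (λ i → suc (x (F.suc i))))
  remQuot-≡ : remQuot k ≡ remQuot k′
  remQuot-≡ = cong₂ _,_ (F.toℕ-injective (k≗k′ F.zero))
    (boxPoint-injective (λ i → x (F.suc i)) _ _ (λ i → k≗k′ (F.suc i)))

lemma6 : (n u : ℕ) (w : Fin n → ℕ) (p : Fin n → ℤ) →
         (∀ i → 1 ≤ w i) → (∀ i → w i ≤ u) →
         (σ : Permutation′ n) (j : ℕ) (x : Fin n → ℕ) →
         IsSol w p j σ x →
         prodℕ (λ i → suc (x i)) ≤ j + 1
lemma6 n u w p _ _ σ j x x-sol@((x-solution , _) , _) =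
  subst (prodℕ (λ i → suc (x i)) ≤_) (ℕ.+-comm 1 j) (F.injective⇒≤ weight-of-injective)
  where
  weight-of-<1+j : ∀ k → weight w (boxPoint x k) < suc j
  weight-of-<1+j k = s≤s (subst (weight w (boxPoint x k) ≤_) x-solution
    (weight-mono-≤ w (boxPoint-≤ᵖ x k)))

  weight-of : Fin (prodℕ (λ i → suc (x i))) → Fin (suc j)
  weight-of k = F.fromℕ< (weight-of-<1+j k)

  weight-of-injective : ∀ {k k′} → weight-of k ≡ weight-of k′ → k ≡ k′
  weight-of-injective {k} {k′} eq = boxPoint-injective x k k′
    (sol-weight-injective {w = w} {p} {σ = σ} x-sol (boxPoint-≤ᵖ x k) (boxPoint-≤ᵖ x k′)
      (trans (sym (F.toℕ-fromℕ< _)) (trans (cong F.toℕ eq) (F.toℕ-fromℕ< _))))
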